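{- Let $p$ be any prime. Let $S\subseteq\mathbb{Z}_p^\times$ be a finite nonempty subset and put $n=|S|$. For $x\in S$ put $v(S,x)=\sum_{s\in S,\,s\ne x}v_p(x-s)$. Then $$\max_{x\in S}v(S,x)\ \ge\ f(n):=\sum_{i=1}^\infty\left\lfloor\frac{n-1}{(p-1)p^{i-1}}\right\rfloor .$$ Moreover, for each $n\in\mathbb{N}$ there exists $S\subseteq\mathbb{Z}_p^\times$ with $|S|=n$ and $\max_{x\in S}v(S,x)=f(n)$. For instance, equality holds when $S$ consists of the first $n$ positive integers prime to $p$.
   Context: $v_p$ denotes the $p$-adic valuation normalized by $v_p(p)=1$. $\mathbb{N}=\mathbb{Z}_{\ge1}$. -}

module Defs where

open import Function using (_∘_)
open import Data.Nat using (ℕ; zero; suc; _+_; _*_; _∸_; _^_; _<_; _≤_)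
open import Data.Nat.DivMod using (_%_; _/_)
open import Data.Nat.Divisibility using (_∣?_)
open import Data.Fin using (Fin; toℕ; _≟_)
import Data.Fin as F
import Data.Nat as N
open import Data.List using (List; []; _∷_; filter; map; upTo)
open import Data.Product using (Σ; _×_; _,_)
open import Relation.Binary.PropositionalEquality using (_≡_; _≢_)
open import Relation.Nullary using (yes; no; ¬?)

-- total versions of floor-division / remainder (only ever used with d > 0)
_mod′_ : ℕ → ℕ → ℕ
m mod′ zero = m
m mod′ suc d = m % suc d

_div′_ : ℕ → ℕ → ℕ
m div′ zero = 0
m div′ suc d = m / suc d

-- ℤ_p as the inverse limit of ℤ/p^k ℤ: res k ∈ {0,…,p^k - 1} is x mod p^k
record ℤₚ (p : ℕ) : Set where
  constructor mkℤₚ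
  field
    res        : ℕ → ℕ
    res-<      : ∀ k → res k < p ^ k
    res-compat : ∀ k → res (suc k) mod′ (p ^ k) ≡ res k
open ℤₚ public

sub : ∀ {p} → ℤₚ p → ℤₚ p → ℕ → ℕ
sub {p} x y k = (res x k + (p ^ k ∸ res y k)) mod′ (p ^ k)

IsUnit : ∀ {p} → ℤₚ p → Set
IsUnit {p} x = Σ (ℤₚ p) λ y → ∀ k → (res x k * res y k) mod′ (p ^ k) ≡ 1 mod′ (p ^ k)

-- x ≠ y (constructive apartness: x - y is nonzero mod some p^k)
Apart : ∀ {p} → ℤₚ p → ℤₚ p → Set
Apart x y = Σ ℕ λ k → sub x y k ≢ 0

valUpTo : (ℕ → ℕ) → ℕ → ℕ
valUpTo z zero = 0
valUpTo z (suc k) with z (suc k) N.≟ 0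
... | yes _ = suc k
... | no _  = valUpTo z k

-- v_p(x - y) for x ≠ y: the largest j with x - y ≡ 0 mod p^j
-- (bounded by the witness k, at which x - y ≢ 0 mod p^k)
vpDiff : ∀ {p} (x y : ℤₚ p) → Apart x y → ℕ
vpDiff x y (k , _) = valUpTo (sub x y) k

sumFin : ∀ {n} → (Fin n → ℕ) → ℕ
sumFin {zero}  f = 0
sumFin {suc n} f = f F.zero + sumFin (f ∘ F.suc)

Distinct : ∀ {p n} → (Fin n → ℤₚ p) → Set
Distinct S = ∀ i j → i ≢ j → Apart (S i) (S j)

vTerm : ∀ {p n} (S : Fin n → ℤₚ p) → Distinct S → Fin n → Fin n → ℕ
vTerm S d x s with x ≟ s
... | yes _ = 0
... | no ne = vpDiff (S x) (S s) (d x s ne)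

vS : ∀ {p n} (S : Fin n → ℤₚ p) → Distinct S → Fin n → ℕ
vS S d x = sumFin (vTerm S d x)

sumFrom1 : (ℕ → ℕ) → ℕ → ℕ
sumFrom1 g zero = 0
sumFrom1 g (suc N) = sumFrom1 g N + g (suc N)

-- f(n) = Σ_{i≥1} ⌊(n-1)/((p-1)p^{i-1})⌋; terms with i > n vanish since
-- (p-1)p^{i-1} ≥ 2^n > n-1, so the sum is truncated at i = n.
f : ℕ → ℕ → ℕ
f p n = sumFrom1 (λ i → (n ∸ 1) div′ ((p ∸ 1) * p ^ (i ∸ 1))) n

IsMax : ∀ {n} → (Fin n → ℕ) → ℕ → Set
IsMax {n} g m = (∀ i → g i ≤ m) × Σ (Fin n) λ i → g i ≡ m

nth : List ℕ → ℕ → ℕ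
nth [] j = 0
nth (x ∷ xs) zero = x
nth (x ∷ xs) (suc j) = nth xs j

-- the (j+1)-th positive integer prime to p (j = 0,1,…); the candidates
-- 1,…,(j+1)p contain (j+1)(p-1) ≥ j+1 integers prime to p when p ≥ 2
coprimeNth : ℕ → ℕ → ℕ
coprimeNth p j = nth (filter (λ m → ¬? (p ∣? m)) (map suc (upTo (suc j * p)))) j

{-# OPTIONS --safe #-}
module Submission where

-- Lower bound: by pigeonhole, S refines into nested clusters C₀ ⊇ C₁ ⊇ ⋯ ⊇ Cₙ whose members
-- are pairwise congruent modulo pⁱ, with |Cᵢ| ≥ n / φ(pⁱ) since units fall into φ(pⁱ) classes
-- modulo pⁱ. Writing v(S, x) = Σᵢ #{s ≠ x : pⁱ ∣ x - s}, any x ∈ Cₙ has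
-- v(S, x) ≥ Σᵢ (|Cᵢ| - 1) ≥ Σᵢ ⌊(n - 1) / φ(pⁱ)⌋ = f(n).
-- Equality: the j-th positive integer prime to p is j + 1 + ⌊j / (p - 1)⌋, a map under which
-- congruence modulo pⁱ of the values means congruence modulo φ(pⁱ) of the indices; among the
-- indices 0, …, n - 1, at most ⌊(n - 1) / φ(pⁱ)⌋ others are congruent to a given one.

open import Defs
open import Function using (_∘_)
open import Data.Bool using (Bool; true; false; _∧_; not; T; if_then_else_)
open import Data.Bool.Properties using (T-∧; T-not-≡)
open import Function.Bundles using (Equivalence)
open import Data.Nat
  using (ℕ; zero; suc; _+_; _*_; _∸_; _^_; _≤_; _<_; z≤n; s≤s; _≡ᵇ_; NonZero)
open import Data.Nat.Properties hiding (_≟_)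
open import Data.Nat.Properties using () renaming (_≟_ to _≟ℕ_)
open import Data.Nat.DivMod
open import Algebra.Properties.CommutativeSemigroup +-commutativeSemigroup using (interchange)
open import Algebra.Properties.CommutativeSemigroup *-commutativeSemigroup using (x∙yz≈y∙xz)
open import Data.Nat.Divisibility using (_∣_; _∣?_; divides; n∣m*n; ∣m+n∣m⇒∣n; ∣⇒≤; ∣-trans; ∣1⇒≡1)
open import Data.Nat.Coprimality using (Coprime; coprime-Bézout; coprime-divisor)
open import Data.Nat.GCD using (module Bézout)
open import Data.Nat.Primality using (Prime; prime⇒irreducible; prime⇒nonTrivial)
open import Data.Nat.Solver using (module +-*-Solver)
open import Data.Fin using (Fin; toℕ; _≟_)
import Data.Fin as F
import Data.Fin.Properties as F
open import Data.Product using (Σ; ∃; _×_; _,_; proj₁; proj₂)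
open import Data.Sum using (inj₁; inj₂)
open import Data.Empty using (⊥-elim)
open import Relation.Binary.PropositionalEquality hiding ([_])
open import Relation.Binary.Definitions using (tri<; tri≈; tri>)
open import Relation.Nullary using (yes; no; does; ¬_; ¬?; Dec)
open import Data.List using ([]; _∷_; _++_; [_]; map; upTo; filter; applyUpTo)
open import Data.List.Properties using (filter-all; filter-reject; filter-++; applyUpTo-∷ʳ; map-upTo; ++-identityʳ)
open import Data.List.Relation.Unary.All using (All; []; _∷_)

open +-*-Solver

mod′< : ∀ m d .{{_ : NonZero d}} → m mod′ d < d
mod′< m (suc d) = m%n<n m (suc d)

<⇒mod′-id : ∀ {m d} .{{_ : NonZero d}} → m < d → m mod′ d ≡ m
<⇒mod′-id {d = suc d} = m<n⇒m%n≡m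

mod′+div′* : ∀ m d .{{_ : NonZero d}} → m ≡ m mod′ d + m div′ d * d
mod′+div′* m (suc d) = m≡m%n+[m/n]*n m (suc d)

mod′-+* : ∀ m k d .{{_ : NonZero d}} → (m + k * d) mod′ d ≡ m mod′ d
mod′-+* m k (suc d) = [m+kn]%n≡m%n m k (suc d)

div′-< : ∀ {m q} d .{{_ : NonZero d}} → m < q * d → m div′ d < q
div′-< (suc d) = m<n*o⇒m/o<n

div′-monoˡ-≤ : ∀ {m n} d → m ≤ n → m div′ d ≤ n div′ d
div′-monoˡ-≤ zero    _ = z≤n
div′-monoˡ-≤ (suc d) m≤n = /-monoˡ-≤ (suc d) m≤n

mod′-div′-injective : ∀ {a b} d .{{_ : NonZero d}} →
  a mod′ d ≡ b mod′ d → a div′ d ≡ b div′ d → a ≡ b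
mod′-div′-injective {a} {b} d ≡mod ≡div = begin
  a                          ≡⟨ mod′+div′* a d ⟩
  a mod′ d + a div′ d * d    ≡⟨ cong₂ (λ r q → r + q * d) ≡mod ≡div ⟩
  b mod′ d + b div′ d * d    ≡⟨ mod′+div′* b d ⟨
  b                          ∎
  where open ≡-Reasoning

mod′-mod′-* : ∀ m q d .{{_ : NonZero q}} .{{_ : NonZero d}} →
  (m mod′ (q * d)) mod′ d ≡ m mod′ d
mod′-mod′-* m (suc q) (suc d) = m∣n⇒o%n%m≡o%m (suc d) (suc q * suc d) m (n∣m*n (suc q))

*-mod′-absorbʳ : ∀ m n d .{{_ : NonZero d}} →
  (m * (n mod′ d)) mod′ d ≡ (m * n) mod′ d
*-mod′-absorbʳ m n (suc d) = begin
  (m * (n % suc d)) % suc d                  ≡⟨ %-distribˡ-* m (n % suc d) (suc d) ⟩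
  (m % suc d * (n % suc d % suc d)) % suc d  ≡⟨ cong (λ t → (m % suc d * t) % suc d) (m%n%n≡m%n n (suc d)) ⟩
  (m % suc d * (n % suc d)) % suc d          ≡⟨ %-distribˡ-* m n (suc d) ⟨
  (m * n) % suc d                            ∎
  where open ≡-Reasoning

[b+[d∸b]]mod′d≡0 : ∀ b d .{{_ : NonZero d}} → b ≤ d → (b + (d ∸ b)) mod′ d ≡ 0
[b+[d∸b]]mod′d≡0 b (suc d) b≤d rewrite m+[n∸m]≡n b≤d = n%n≡0 (suc d)

[a+[d∸b]]mod′d≡0⇒a≡b : ∀ {a b} d .{{_ : NonZero d}} → a < d → b < d →
  (a + (d ∸ b)) mod′ d ≡ 0 → a ≡ b
[a+[d∸b]]mod′d≡0⇒a≡b {a} {b} (suc d) a<d b<d ≡0 = begin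
  a                                          ≡⟨ m<n⇒m%n≡m a<d ⟨
  a % D                                      ≡⟨ [m+n]%n≡m%n a D ⟨
  (a + D) % D                                ≡⟨ cong (_% D) a+D≡ ⟩
  (a + (D ∸ b) + b) % D                      ≡⟨ %-distribˡ-+ (a + (D ∸ b)) b D ⟩
  ((a + (D ∸ b)) % D + b % D) % D            ≡⟨ cong (λ t → (t + b % D) % D) ≡0 ⟩
  b % D % D                                  ≡⟨ m%n%n≡m%n b D ⟩
  b % D                                      ≡⟨ m<n⇒m%n≡m b<d ⟩
  b                                          ∎
  where
  open ≡-Reasoning
  D : ℕ
  D = suc d
  a+D≡ : a + D ≡ a + (D ∸ b) + b
  a+D≡ = trans (cong (a +_) (sym (m∸n+n≡m (<⇒≤ b<d)))) (sym (+-assoc a (D ∸ b) b))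

mod′-*-inverse : ∀ a c b d .{{_ : NonZero d}} →
  (c * b) mod′ d ≡ 1 mod′ d → (a * (c * b)) mod′ d ≡ a mod′ d
mod′-*-inverse a c b d cb≡1 = begin
  (a * (c * b)) mod′ d           ≡⟨ *-mod′-absorbʳ a (c * b) d ⟨
  (a * ((c * b) mod′ d)) mod′ d  ≡⟨ cong (λ t → (a * t) mod′ d) cb≡1 ⟩
  (a * (1 mod′ d)) mod′ d        ≡⟨ *-mod′-absorbʳ a 1 d ⟩
  (a * 1) mod′ d                 ≡⟨ cong (_mod′ d) (*-identityʳ a) ⟩
  a mod′ d                       ∎
  where open ≡-Reasoning

inverse-unique : ∀ {c a b} d .{{_ : NonZero d}} →
  (c * a) mod′ d ≡ 1 mod′ d → (c * b) mod′ d ≡ 1 mod′ d → a mod′ d ≡ b mod′ d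
inverse-unique {c} {a} {b} d ca≡1 cb≡1 = begin
  a mod′ d                ≡⟨ mod′-*-inverse a c b d cb≡1 ⟨
  (a * (c * b)) mod′ d    ≡⟨ cong (_mod′ d) (solve 3 (λ a b c → a :* (c :* b) := b :* (c :* a)) refl a b c) ⟩
  (b * (c * a)) mod′ d    ≡⟨ mod′-*-inverse b c a d ca≡1 ⟩
  b mod′ d                ∎
  where open ≡-Reasoning

mod′-inverse : ∀ {c} d .{{_ : NonZero d}} → Coprime c d → ∃ λ u → (c * u) mod′ d ≡ 1 mod′ d
mod′-inverse {c} (suc d) c⊥d with coprime-Bézout c⊥d
... | Bézout.+- x y 1+yd≡xc = x , (begin
  (c * x) % suc d            ≡⟨ cong (_% suc d) (trans (*-comm c x) (sym 1+yd≡xc)) ⟩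
  (1 + y * suc d) % suc d    ≡⟨ [m+kn]%n≡m%n 1 y (suc d) ⟩
  1 % suc d                  ∎)
  where open ≡-Reasoning
... | Bézout.-+ x y 1+xc≡yd = x * d , (begin
  (c * (x * d)) % suc d                  ≡⟨ [m+kn]%n≡m%n (c * (x * d)) y (suc d) ⟨
  (c * (x * d) + y * suc d) % suc d      ≡⟨ cong (λ t → (c * (x * d) + t) % suc d) (sym 1+xc≡yd) ⟩
  (c * (x * d) + (1 + x * c)) % suc d    ≡⟨ cong (_% suc d) (solve 3 (λ c x d → c :* (x :* d) :+ (con 1 :+ x :* c)
                                                                      := con 1 :+ (c :* x) :* (con 1 :+ d)) refl c x d) ⟩
  (1 + (c * x) * suc d) % suc d          ≡⟨ [m+kn]%n≡m%n 1 (c * x) (suc d) ⟩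
  1 % suc d                              ∎)
  where open ≡-Reasoning

coprime-^ : ∀ {p c} → Prime p → ¬ p ∣ c → ∀ k → Coprime c (p ^ k)
coprime-^         pr p∤c zero    (_ , d∣1)        = ∣1⇒≡1 d∣1
coprime-^ {p} {c} pr p∤c (suc k) (d∣c , d∣pᵏ⁺¹) = coprime-^ pr p∤c k (d∣c , coprime-divisor d⊥p d∣pᵏ⁺¹)
  where
  d⊥p : Coprime _ p
  d⊥p (e∣d , e∣p) with prime⇒irreducible pr e∣p
  ... | inj₁ e≡1 = e≡1
  ... | inj₂ refl = ⊥-elim (p∤c (∣-trans e∣d d∣c))

toℕ≤n∸1 : ∀ {n} (i : Fin n) → toℕ i ≤ n ∸ 1
toℕ≤n∸1 F.zero    = z≤n
toℕ≤n∸1 (F.suc i) = F.toℕ<n i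

count : ∀ {n} → (Fin n → Bool) → ℕ
count P = sumFin (λ s → if P s then 1 else 0)

count-all : ∀ {n} → count {n} (λ _ → true) ≡ n
count-all {zero}  = refl
count-all {suc n} = cong suc count-all

count-none : ∀ {n} (P : Fin n → Bool) → (∀ s → ¬ T (P s)) → count P ≡ 0
count-none {zero}  P ¬P = refl
count-none {suc n} P ¬P with P F.zero in eq
... | true  = ⊥-elim (¬P F.zero (subst T (sym eq) _))
... | false = count-none (P ∘ F.suc) (¬P ∘ F.suc)

count-mono : ∀ {n} (P Q : Fin n → Bool) → (∀ s → T (P s) → T (Q s)) → count P ≤ count Q
count-mono {zero}  P Q P⇒Q = z≤n
count-mono {suc n} P Q P⇒Q = +-mono-≤ (head (P F.zero) (Q F.zero) (P⇒Q F.zero))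
                                       (count-mono (P ∘ F.suc) (Q ∘ F.suc) (P⇒Q ∘ F.suc))
  where
  head : ∀ a b → (T a → T b) → (if a then 1 else 0) ≤ (if b then 1 else 0)
  head true  true  _   = ≤-refl
  head true  false a⇒b = ⊥-elim (a⇒b _)
  head false _     _   = z≤n

count-split : ∀ {n} (P b : Fin n → Bool) →
  count P ≡ count (λ s → P s ∧ b s) + count (λ s → P s ∧ not (b s))
count-split {zero}  P b = refl
count-split {suc n} P b
  rewrite count-split (P ∘ F.suc) (b ∘ F.suc) with P F.zero | b F.zero
... | true  | true  = refl
... | true  | false = sym (+-suc _ _)
... | false | _     = refl

count-≤1 : ∀ {n} (P : Fin n → Bool) → (∀ s s′ → T (P s) → T (P s′) → s ≡ s′) → count P ≤ 1
count-≤1 {zero}  P unique = z≤n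
count-≤1 {suc n} P unique with P F.zero in eq
... | true  = ≤-reflexive (cong suc (count-none (P ∘ F.suc) λ s Ps →
                F.0≢1+n (unique F.zero (F.suc s) (subst T (sym eq) _) Ps)))
... | false = count-≤1 (P ∘ F.suc) (λ s s′ Ps Ps′ → F.suc-injective (unique _ _ Ps Ps′))

count>0⇒∃ : ∀ {n} (P : Fin n → Bool) → 0 < count P → ∃ λ s → T (P s)
count>0⇒∃ {suc n} P 0<count with P F.zero in eq
... | true  = F.zero , subst T (sym eq) _
... | false = let s , Ps = count>0⇒∃ (P ∘ F.suc) 0<count in F.suc s , Ps

count-remove : ∀ {n} (P : Fin n → Bool) x → T (P x) →
  count P ≡ suc (count (λ s → not (does (x ≟ s)) ∧ P s))
count-remove {suc n} P F.zero    Px with P F.zero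
... | true = refl
count-remove {suc n} P (F.suc x) Px with P F.zero
... | true  = cong suc (count-remove (P ∘ F.suc) x Px)
... | false = count-remove (P ∘ F.suc) x Px

T-not-≡ᵇ⇒≢ : ∀ {a b} → T (not (a ≡ᵇ b)) → a ≢ b
T-not-≡ᵇ⇒≢ {a} {b} t a≡b = subst T (Equivalence.to T-not-≡ t) (≡⇒≡ᵇ a b a≡b)

pigeonhole : ∀ {n} m (P : Fin n → Bool) (g : Fin n → ℕ) → (∀ s → T (P s) → g s < m) →
  ∃ λ b → count P ≤ m * count (λ s → P s ∧ (g s ≡ᵇ b))
pigeonhole zero P g g< = 0 , ≤-reflexive (count-none P λ s Ps → n≮0 (g< s Ps))
pigeonhole {n} (suc m) P g g< = choose (count A ≤? count (C b))
  where
  A B : Fin n → Bool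
  A s = P s ∧ (g s ≡ᵇ m)
  B s = P s ∧ not (g s ≡ᵇ m)
  C : ℕ → Fin n → Bool
  C b s = P s ∧ (g s ≡ᵇ b)

  g<m : ∀ s → T (B s) → g s < m
  g<m s Bs = let Ps , gs≢m = Equivalence.to (T-∧ {P s}) Bs in ≤∧≢⇒< (≤-pred (g< s Ps)) (T-not-≡ᵇ⇒≢ gs≢m)

  b : ℕ
  b = proj₁ (pigeonhole m B g g<m)

  B∧Cb⇒Cb : ∀ s → T (B s ∧ (g s ≡ᵇ b)) → T (C b s)
  B∧Cb⇒Cb s t = let Bs , gs≡b = Equivalence.to (T-∧ {B s}) t in
    Equivalence.from T-∧ (proj₁ (Equivalence.to (T-∧ {P s}) Bs) , gs≡b)

  countB≤ : count B ≤ m * count (C b)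
  countB≤ = ≤-trans (proj₂ (pigeonhole m B g g<m)) (*-monoʳ-≤ m (count-mono _ (C b) B∧Cb⇒Cb))

  open ≤-Reasoning

  choose : Dec (count A ≤ count (C b)) → ∃ λ b′ → count P ≤ suc m * count (C b′)
  choose (yes A≤Cb) = b , (begin
    count P                      ≡⟨ count-split P (λ s → g s ≡ᵇ m) ⟩
    count A + count B            ≤⟨ +-mono-≤ A≤Cb countB≤ ⟩
    count (C b) + m * count (C b) ∎)
  choose (no A≰Cb) = m , (begin
    count P                      ≡⟨ count-split P (λ s → g s ≡ᵇ m) ⟩
    count A + count B            ≤⟨ +-monoʳ-≤ (count A) countB≤ ⟩
    count A + m * count (C b)    ≤⟨ +-monoʳ-≤ (count A) (*-monoʳ-≤ m (<⇒≤ (≰⇒> A≰Cb))) ⟩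
    count A + m * count A        ∎)

count≤-injective : ∀ {n} m (P : Fin n → Bool) (g : Fin n → ℕ) → (∀ s → T (P s) → g s < m) →
  (∀ s s′ → T (P s) → T (P s′) → g s ≡ g s′ → s ≡ s′) → count P ≤ m
count≤-injective m P g g< g-injective = let b , P≤ = pigeonhole m P g g< in begin
  count P                               ≤⟨ P≤ ⟩
  m * count (λ s → P s ∧ (g s ≡ᵇ b))    ≤⟨ *-monoʳ-≤ m (count-≤1 _ (fibre-unique b)) ⟩
  m * 1                                 ≡⟨ *-identityʳ m ⟩
  m                                     ∎
  where
  open ≤-Reasoning
  fibre-unique : ∀ b s s′ → T (P s ∧ (g s ≡ᵇ b)) → T (P s′ ∧ (g s′ ≡ᵇ b)) → s ≡ s′
  fibre-unique b s s′ t t′ =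
    let Ps , gs≡b = Equivalence.to (T-∧ {P s}) t ; Ps′ , gs′≡b = Equivalence.to (T-∧ {P s′}) t′ in
    g-injective s s′ Ps Ps′ (trans (≡ᵇ⇒≡ _ b gs≡b) (sym (≡ᵇ⇒≡ _ b gs′≡b)))

sumFin-+ : ∀ {n} (f g : Fin n → ℕ) → sumFin (λ s → f s + g s) ≡ sumFin f + sumFin g
sumFin-+ {zero}  f g = refl
sumFin-+ {suc n} f g = trans (cong (f F.zero + g F.zero +_) (sumFin-+ (f ∘ F.suc) (g ∘ F.suc)))
                             (interchange (f F.zero) (g F.zero) _ _)

sumFin-0 : ∀ n → sumFin {n} (λ _ → 0) ≡ 0
sumFin-0 zero    = refl
sumFin-0 (suc n) = sumFin-0 n

sumFrom1-0 : ∀ N → sumFrom1 (λ _ → 0) N ≡ 0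
sumFrom1-0 zero    = refl
sumFrom1-0 (suc N) = trans (+-identityʳ _) (sumFrom1-0 N)

sumFin-sumFrom1-comm : ∀ {n} N (h : Fin n → ℕ → ℕ) →
  sumFin (λ s → sumFrom1 (h s) N) ≡ sumFrom1 (λ i → sumFin (λ s → h s i)) N
sumFin-sumFrom1-comm {n} zero    h = sumFin-0 n
sumFin-sumFrom1-comm     (suc N) h =
  trans (sumFin-+ (λ s → sumFrom1 (h s) N) (λ s → h s (suc N)))
        (cong (_+ sumFin (λ s → h s (suc N))) (sumFin-sumFrom1-comm N h))

sumFin-mono : ∀ {n} (f g : Fin n → ℕ) → (∀ s → f s ≤ g s) → sumFin f ≤ sumFin g
sumFin-mono {zero}  f g f≤g = z≤n
sumFin-mono {suc n} f g f≤g = +-mono-≤ (f≤g F.zero) (sumFin-mono (f ∘ F.suc) (g ∘ F.suc) (f≤g ∘ F.suc))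

sumFrom1-mono : ∀ N (f g : ℕ → ℕ) → (∀ i → 1 ≤ i → i ≤ N → f i ≤ g i) → sumFrom1 f N ≤ sumFrom1 g N
sumFrom1-mono zero    f g f≤g = z≤n
sumFrom1-mono (suc N) f g f≤g =
  +-mono-≤ (sumFrom1-mono N f g λ i 1≤i i≤N → f≤g i 1≤i (m≤n⇒m≤1+n i≤N)) (f≤g (suc N) (s≤s z≤n) ≤-refl)

DownClosed : (ℕ → ℕ) → Set
DownClosed z = ∀ i → z (suc i) ≡ 0 → z i ≡ 0

-- Reading v_p(x - y) as the number of i ≥ 1 with p ^ i ∣ x - y, rather than as a maximum,
-- turns v(S, x) into a double sum whose order can be exchanged.
zeroCount : (ℕ → ℕ) → ℕ → ℕ
zeroCount z = sumFrom1 (λ i → if z i ≡ᵇ 0 then 1 else 0)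

DownClosed-+ : ∀ {z} → DownClosed z → ∀ d {i} → z (d + i) ≡ 0 → z i ≡ 0
DownClosed-+ closed zero        zi≡0   = zi≡0
DownClosed-+ closed (suc d) {i} zdi≡0 = DownClosed-+ closed d (closed (d + i) zdi≡0)

DownClosed-≤ : ∀ {z} → DownClosed z → ∀ {i j} → i ≤ j → z j ≡ 0 → z i ≡ 0
DownClosed-≤ {z} closed {i} {j} i≤j zj≡0 =
  DownClosed-+ closed (j ∸ i) (subst (λ t → z t ≡ 0) (sym (m∸n+n≡m i≤j)) zj≡0)

≢0⇒indicator≡0 : ∀ {m} → m ≢ 0 → (if m ≡ᵇ 0 then 1 else 0) ≡ 0
≢0⇒indicator≡0 {zero}  m≢0 = ⊥-elim (m≢0 refl)
≢0⇒indicator≡0 {suc m} _   = refl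

zeroCount-full : ∀ z N → (∀ i → i ≤ N → z i ≡ 0) → zeroCount z N ≡ N
zeroCount-full z zero    zeros = refl
zeroCount-full z (suc N) zeros rewrite zeros (suc N) ≤-refl =
  trans (cong (_+ 1) (zeroCount-full z N λ i i≤N → zeros i (m≤n⇒m≤1+n i≤N))) (+-comm N 1)

valUpTo≡zeroCount : ∀ {z} → DownClosed z → ∀ k → valUpTo z k ≡ zeroCount z k
valUpTo≡zeroCount         closed zero    = refl
valUpTo≡zeroCount {z} closed (suc k) with z (suc k) ≟ℕ 0
... | yes zk+1≡0 = sym (zeroCount-full z (suc k) λ i i≤k+1 → DownClosed-≤ closed i≤k+1 zk+1≡0)
... | no  zk+1≢0 rewrite ≢0⇒indicator≡0 zk+1≢0 = trans (valUpTo≡zeroCount closed k) (sym (+-identityʳ _))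

zeroCount-mono : ∀ z {a b} → a ≤ b → zeroCount z a ≤ zeroCount z b
zeroCount-mono z {a} {b} a≤b = subst (λ t → zeroCount z a ≤ zeroCount z t) (m∸n+n≡m a≤b) (go (b ∸ a))
  where
  go : ∀ d → zeroCount z a ≤ zeroCount z (d + a)
  go zero    = ≤-refl
  go (suc d) = ≤-trans (go d) (m≤m+n _ _)

zeroCount-stable : ∀ z b → (∀ i → b < i → z i ≢ 0) → ∀ a → zeroCount z a ≤ zeroCount z b
zeroCount-stable z b nonzero zero = z≤n
zeroCount-stable z b nonzero (suc a) with suc a ≤? b
... | yes a+1≤b = zeroCount-mono z a+1≤b
... | no  a+1≰b rewrite ≢0⇒indicator≡0 (nonzero (suc a) (≰⇒> a+1≰b)) =
  ≤-trans (≤-reflexive (+-identityʳ _)) (zeroCount-stable z b nonzero a)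

applyUpTo-++ : ∀ (g : ℕ → ℕ) m k → applyUpTo g (m + k) ≡ applyUpTo g m ++ applyUpTo (λ i → g (m + i)) k
applyUpTo-++ g zero    k = refl
applyUpTo-++ g (suc m) k = cong (g 0 ∷_) (applyUpTo-++ (g ∘ suc) m k)

applyUpTo-cong : ∀ {g h : ℕ → ℕ} m → (∀ i → i < m → g i ≡ h i) → applyUpTo g m ≡ applyUpTo h m
applyUpTo-cong zero    g≡h = refl
applyUpTo-cong (suc m) g≡h = cong₂ _∷_ (g≡h 0 (s≤s z≤n)) (applyUpTo-cong m λ i i<m → g≡h (suc i) (s≤s i<m))

All-applyUpTo : ∀ {P : ℕ → Set} (g : ℕ → ℕ) m → (∀ i → i < m → P (g i)) → All P (applyUpTo g m)
All-applyUpTo g zero    Pg = []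
All-applyUpTo g (suc m) Pg = Pg 0 (s≤s z≤n) ∷ All-applyUpTo (g ∘ suc) m λ i i<m → Pg (suc i) (s≤s i<m)

nth-applyUpTo : ∀ (g : ℕ → ℕ) {m j} → j < m → nth (applyUpTo g m) j ≡ g j
nth-applyUpTo g {suc m} {zero}  _         = refl
nth-applyUpTo g {suc m} {suc j} (s≤s j<m) = nth-applyUpTo (g ∘ suc) j<m

module Padic (r : ℕ) where

  p : ℕ
  p = suc (suc r)

  pᵏ≢0 : ∀ k → NonZero (p ^ k)
  pᵏ≢0 k = m^n≢0 p k

  sub≡0⇒res≡ : ∀ (x y : ℤₚ p) k → sub x y k ≡ 0 → res x k ≡ res y k
  sub≡0⇒res≡ x y k = [a+[d∸b]]mod′d≡0⇒a≡b (p ^ k) {{pᵏ≢0 k}} (res-< x k) (res-< y k)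

  res≡⇒sub≡0 : ∀ (x y : ℤₚ p) k → res x k ≡ res y k → sub x y k ≡ 0
  res≡⇒sub≡0 x y k xk≡yk rewrite xk≡yk = [b+[d∸b]]mod′d≡0 (res y k) (p ^ k) {{pᵏ≢0 k}} (<⇒≤ (res-< y k))

  res≡-pred : ∀ (x y : ℤₚ p) k → res x (suc k) ≡ res y (suc k) → res x k ≡ res y k
  res≡-pred x y k xk+1≡yk+1 =
    trans (sym (res-compat x k)) (trans (cong (_mod′ (p ^ k)) xk+1≡yk+1) (res-compat y k))

  sub-DownClosed : ∀ (x y : ℤₚ p) → DownClosed (sub x y)
  sub-DownClosed x y k = res≡⇒sub≡0 x y k ∘ res≡-pred x y k ∘ sub≡0⇒res≡ x y (suc k)

  res₀≡0 : ∀ (x : ℤₚ p) → res x 0 ≡ 0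
  res₀≡0 x = n<1⇒n≡0 (res-< x 0)

  unit⇒res₁>0 : ∀ (x : ℤₚ p) → IsUnit x → 0 < res x 1
  unit⇒res₁>0 x (y , xy≡1) = n≢0⇒n>0 λ x₁≡0 →
    0≢1+n (subst (λ t → (t * res y 1) mod′ (p ^ 1) ≡ 1) x₁≡0 (xy≡1 1))

  module Agreement {n} (S : Fin n → ℤₚ p) where

    agrees : Fin n → Fin n → ℕ → Bool
    agrees x s i = not (does (x ≟ s)) ∧ (sub (S x) (S s) i ≡ᵇ 0)

    agreeCount : Fin n → ℕ → ℕ
    agreeCount x i = count (λ s → agrees x s i)

    private
      truncatedVal : Fin n → Fin n → ℕ → ℕ
      truncatedVal x s = sumFrom1 (λ i → if agrees x s i then 1 else 0)

      vTerm-lower : ∀ distinct x s N → truncatedVal x s N ≤ vTerm S distinct x s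
      vTerm-lower distinct x s N with x ≟ s
      ... | yes _ = ≤-reflexive (sumFrom1-0 N)
      ... | no x≢s with distinct x s x≢s
      ... | k , zk≢0 = begin
        zeroCount z N  ≤⟨ zeroCount-stable z k nonzero-above-k N ⟩
        zeroCount z k  ≡⟨ valUpTo≡zeroCount (sub-DownClosed (S x) (S s)) k ⟨
        valUpTo z k    ∎
        where
        open ≤-Reasoning
        z : ℕ → ℕ
        z = sub (S x) (S s)
        nonzero-above-k : ∀ i → k < i → z i ≢ 0
        nonzero-above-k i k<i zi≡0 = zk≢0 (DownClosed-≤ (sub-DownClosed (S x) (S s)) (<⇒≤ k<i) zi≡0)

      vTerm-upper : ∀ distinct x s N → (∀ i → N < i → x ≢ s → sub (S x) (S s) i ≢ 0) →
        vTerm S distinct x s ≤ truncatedVal x s N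
      vTerm-upper distinct x s N apart with x ≟ s
      ... | yes _   = z≤n
      ... | no x≢s with distinct x s x≢s
      ... | k , _ = begin
        valUpTo z k    ≡⟨ valUpTo≡zeroCount (sub-DownClosed (S x) (S s)) k ⟩
        zeroCount z k  ≤⟨ zeroCount-stable z N (λ i N<i → apart i N<i x≢s) k ⟩
        zeroCount z N  ∎
        where
        open ≤-Reasoning
        z : ℕ → ℕ
        z = sub (S x) (S s)

    agreeCount≤vS : ∀ distinct x N → sumFrom1 (agreeCount x) N ≤ vS S distinct x
    agreeCount≤vS distinct x N = begin
      sumFrom1 (agreeCount x) N                 ≡⟨ sumFin-sumFrom1-comm N (λ s i → if agrees x s i then 1 else 0) ⟨
      sumFin (λ s → truncatedVal x s N)         ≤⟨ sumFin-mono _ _ (λ s → vTerm-lower distinct x s N) ⟩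
      vS S distinct x                           ∎
      where open ≤-Reasoning

    vS≤agreeCount : ∀ distinct x N → (∀ s i → N < i → x ≢ s → sub (S x) (S s) i ≢ 0) →
      vS S distinct x ≤ sumFrom1 (agreeCount x) N
    vS≤agreeCount distinct x N apart = begin
      vS S distinct x                           ≤⟨ sumFin-mono _ _ (λ s → vTerm-upper distinct x s N (apart s)) ⟩
      sumFin (λ s → truncatedVal x s N)         ≡⟨ sumFin-sumFrom1-comm N (λ s i → if agrees x s i then 1 else 0) ⟩
      sumFrom1 (agreeCount x) N                 ∎
      where open ≤-Reasoning

  φ : ℕ → ℕ
  φ zero    = 1
  φ (suc j) = (p ∸ 1) * p ^ j

  φ≢0 : ∀ j → NonZero (φ j)
  φ≢0 zero    = _
  φ≢0 (suc j) = m*n≢0 (suc r) (p ^ j) {{_}} {{pᵏ≢0 j}}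

  φ-suc : ∀ j → φ (suc (suc j)) ≡ p * φ (suc j)
  φ-suc j = x∙yz≈y∙xz (suc r) p (p ^ j)

  module LowerBound {n} (S : Fin n → ℤₚ p) (units : ∀ i → IsUnit (S i)) where

    record Cluster (j : ℕ) : Set where
      field
        member : Fin n → Bool
        agree  : ∀ s s′ → T (member s) → T (member s′) → res (S s) j ≡ res (S s′) j
        large  : n ≤ count member * φ j
    open Cluster

    _⊆_ : ∀ {i j} → Cluster i → Cluster j → Set
    C ⊆ D = ∀ s → T (member C s) → T (member D s)

    everything : Cluster 0
    everything = record
      { member = λ _ → true
      ; agree  = λ s s′ _ _ → trans (res₀≡0 (S s)) (sym (res₀≡0 (S s′)))
      ; large  = ≤-reflexive (sym (trans (*-identityʳ _) count-all))
      }

    refine : ∀ {j} (C : Cluster j) m (digit : Fin n → ℕ) → (∀ s → digit s < m) →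
      (∀ s s′ → res (S s) j ≡ res (S s′) j → digit s ≡ digit s′ →
        res (S s) (suc j) ≡ res (S s′) (suc j)) →
      φ (suc j) ≡ m * φ j → Σ (Cluster (suc j)) (_⊆ C)
    refine {j} C m digit digit<m determines φ-step =
      record { member = member′ ; agree = agree′ ; large = large′ } , λ s → proj₁ ∘ Equivalence.to (T-∧ {member C s})
      where
      popular : ∃ λ b → count (member C) ≤ m * count (λ s → member C s ∧ (digit s ≡ᵇ b))
      popular = pigeonhole m (member C) digit λ s _ → digit<m s
      b : ℕ
      b = proj₁ popular
      member′ : Fin n → Bool
      member′ s = member C s ∧ (digit s ≡ᵇ b)
      agree′ : ∀ s s′ → T (member′ s) → T (member′ s′) → res (S s) (suc j) ≡ res (S s′) (suc j)
      agree′ s s′ t t′ =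
        let Cs , ds≡b = Equivalence.to (T-∧ {member C s}) t ; Cs′ , ds′≡b = Equivalence.to (T-∧ {member C s′}) t′ in
        determines s s′ (agree C s s′ Cs Cs′) (trans (≡ᵇ⇒≡ _ b ds≡b) (sym (≡ᵇ⇒≡ _ b ds′≡b)))
      large′ : n ≤ count member′ * φ (suc j)
      large′ = begin
        n                                ≤⟨ large C ⟩
        count (member C) * φ j           ≤⟨ *-monoˡ-≤ (φ j) (proj₂ popular) ⟩
        m * count member′ * φ j          ≡⟨ cong (_* φ j) (*-comm m _) ⟩
        count member′ * m * φ j          ≡⟨ *-assoc (count member′) m (φ j) ⟩
        count member′ * (m * φ j)        ≡⟨ cong (count member′ *_) φ-step ⟨
        count member′ * φ (suc j)        ∎
        where open ≤-Reasoning

    refine-step : ∀ j (C : Cluster j) → Σ (Cluster (suc j)) (_⊆ C)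
    refine-step zero C = refine C (suc r) (λ s → res (S s) 1 ∸ 1) digit< determines refl
      where
      res₁<p : ∀ s → res (S s) 1 < p
      res₁<p s = subst (res (S s) 1 <_) (*-identityʳ p) (res-< (S s) 1)
      digit< : ∀ s → res (S s) 1 ∸ 1 < suc r
      digit< s = ∸-monoˡ-< (res₁<p s) (unit⇒res₁>0 (S s) (units s))
      determines : ∀ s s′ → _ → res (S s) 1 ∸ 1 ≡ res (S s′) 1 ∸ 1 → res (S s) 1 ≡ res (S s′) 1
      determines s s′ _ = ∸-cancelʳ-≡ (unit⇒res₁>0 (S s) (units s)) (unit⇒res₁>0 (S s′) (units s′))
    refine-step (suc j) C = refine C p digit digit< determines (φ-suc j)
      where
      instance _ = pᵏ≢0 (suc j)
      digit : Fin n → ℕ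
      digit s = res (S s) (suc (suc j)) div′ (p ^ suc j)
      digit< : ∀ s → digit s < p
      digit< s = div′-< (p ^ suc j) (res-< (S s) (suc (suc j)))
      determines : ∀ s s′ → res (S s) (suc j) ≡ res (S s′) (suc j) → digit s ≡ digit s′ →
        res (S s) (suc (suc j)) ≡ res (S s′) (suc (suc j))
      determines s s′ low≡ = mod′-div′-injective (p ^ suc j)
        (trans (res-compat (S s) (suc j)) (trans low≡ (sym (res-compat (S s′) (suc j)))))

    cluster : ∀ j → Cluster j
    cluster zero    = everything
    cluster (suc j) = proj₁ (refine-step j (cluster j))

    cluster-antitone : ∀ {i j} → i ≤ j → cluster j ⊆ cluster i
    cluster-antitone {i} {j} i≤j s = subst (λ t → T (member (cluster t) s) → T (member (cluster i) s))
                                           (m∸n+n≡m i≤j) (descend (j ∸ i))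
      where
      descend : ∀ d → T (member (cluster (d + i)) s) → T (member (cluster i) s)
      descend zero    = λ s∈C → s∈C
      descend (suc d) = descend d ∘ proj₂ (refine-step (d + i) (cluster (d + i))) s

    open Agreement S

    cluster-bounds-agreeCount : ∀ x j → T (member (cluster (suc j)) x) →
      count (member (cluster (suc j))) ≤ suc (agreeCount x (suc j))
    cluster-bounds-agreeCount x j x∈C = begin
      count (member C)                                   ≤⟨ count-mono _ _ agrees-mod-pʲ⁺¹ ⟩
      count (λ s → sub (S x) (S s) (suc j) ≡ᵇ 0)         ≡⟨ count-remove _ x (≡⇒≡ᵇ _ 0 (res≡⇒sub≡0 (S x) (S x) (suc j) refl)) ⟩
      suc (agreeCount x (suc j))                         ∎
      where
      open ≤-Reasoning
      C : Cluster (suc j)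
      C = cluster (suc j)
      agrees-mod-pʲ⁺¹ : ∀ s → T (member C s) → T (sub (S x) (S s) (suc j) ≡ᵇ 0)
      agrees-mod-pʲ⁺¹ s s∈C = ≡⇒≡ᵇ _ 0 (res≡⇒sub≡0 (S x) (S s) (suc j) (agree C x s x∈C s∈C))

    lowerBound : 0 < n → (distinct : Distinct S) → ∃ λ x → f p n ≤ vS S distinct x
    lowerBound 0<n distinct = x , (begin
      f p n                       ≤⟨ sumFrom1-mono n _ _ (λ { (suc j) _ j<n → level-bound j j<n }) ⟩
      sumFrom1 (agreeCount x) n   ≤⟨ agreeCount≤vS distinct x n ⟩
      vS S distinct x             ∎)
      where
      open ≤-Reasoning
      deepest : ∃ λ x → T (member (cluster n) x)
      deepest = count>0⇒∃ _ (n≢0⇒n>0 λ count≡0 →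
        <⇒≱ 0<n (≤-trans (large (cluster n)) (≤-reflexive (cong (_* φ n) count≡0))))
      x : Fin n
      x = proj₁ deepest
      level-bound : ∀ j → suc j ≤ n → (n ∸ 1) div′ φ (suc j) ≤ agreeCount x (suc j)
      level-bound j j<n = ≤-pred (≤-trans quotient<count (cluster-bounds-agreeCount x j x∈C))
        where
        instance _ = φ≢0 (suc j)
        C : Cluster (suc j)
        C = cluster (suc j)
        x∈C : T (member C x)
        x∈C = cluster-antitone j<n x (proj₂ deepest)
        quotient<count : (n ∸ 1) div′ φ (suc j) < count (member C)
        quotient<count = div′-< (φ (suc j)) (<-≤-trans (∸-monoʳ-< {n} {1} {0} (s≤s z≤n) 0<n) (large C))

  -- The integers prime to p come in runs of p - 1 separated by single multiples of p, so the
  -- j-th of them (counting from 0) is j + 1 plus the ⌊j / (p - 1)⌋ multiples skipped before it.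
  nthCoprime : ℕ → ℕ
  nthCoprime j = j + j / suc r + 1

  prime-to-p : ∀ m → Dec (¬ p ∣ m)
  prime-to-p m = ¬? (p ∣? m)

  nthCoprime-block : ∀ q t → t < suc r → nthCoprime (q * suc r + t) ≡ suc (q * p + t)
  nthCoprime-block q t t<Q = begin
    q * suc r + t + (q * suc r + t) / suc r + 1
      ≡⟨ cong (λ z → q * suc r + t + z + 1) (+-distrib-/-∣ˡ t (n∣m*n q)) ⟩
    q * suc r + t + (q * suc r / suc r + t / suc r) + 1
      ≡⟨ cong₂ (λ a b → q * suc r + t + (a + b) + 1) (m*n/n≡m q (suc r)) (m<n⇒m/n≡0 t<Q) ⟩
    q * suc r + t + (q + 0) + 1
      ≡⟨ solve 3 (λ q t r → q :* (con 1 :+ r) :+ t :+ (q :+ con 0) :+ con 1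
                           := con 1 :+ (q :* (con 2 :+ r) :+ t)) refl q t r ⟩
    suc (q * p + t)
      ∎
    where open ≡-Reasoning

  p∤[qp+1+i] : ∀ q i → i < suc r → ¬ p ∣ suc (q * p + i)
  p∤[qp+1+i] q i i<Q p∣ =
    <⇒≱ (s≤s i<Q) (∣⇒≤ (∣m+n∣m⇒∣n (subst (p ∣_) (sym (+-suc (q * p) i)) p∣) (n∣m*n q)))

  filter-block : ∀ q → filter prime-to-p (applyUpTo (λ i → suc (q * p + i)) p)
                     ≡ applyUpTo (λ t → nthCoprime (q * suc r + t)) (suc r)
  filter-block q = begin
    filter prime-to-p (applyUpTo block p)                            ≡⟨ cong (filter prime-to-p) (applyUpTo-∷ʳ block (suc r)) ⟨
    filter prime-to-p (applyUpTo block (suc r) ++ [ block (suc r) ]) ≡⟨ filter-++ prime-to-p (applyUpTo block (suc r)) _ ⟩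
    filter prime-to-p (applyUpTo block (suc r)) ++ filter prime-to-p [ block (suc r) ]
      ≡⟨ cong₂ _++_ (filter-all prime-to-p (All-applyUpTo block (suc r) (p∤[qp+1+i] q)))
                    (filter-reject prime-to-p (λ p∤ → p∤ last-divisible)) ⟩
    applyUpTo block (suc r) ++ []                                    ≡⟨ ++-identityʳ _ ⟩
    applyUpTo block (suc r)                                          ≡⟨ applyUpTo-cong (suc r) (λ t t<Q → sym (nthCoprime-block q t t<Q)) ⟩
    applyUpTo (λ t → nthCoprime (q * suc r + t)) (suc r)             ∎
    where
    open ≡-Reasoning
    block : ℕ → ℕ
    block i = suc (q * p + i)
    last-divisible : p ∣ block (suc r)
    last-divisible = divides (suc q) (trans (sym (+-suc (q * p) (suc r))) (+-comm (q * p) p))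

  filter-prime-to-p : ∀ q → filter prime-to-p (applyUpTo suc (q * p)) ≡ applyUpTo nthCoprime (q * suc r)
  filter-prime-to-p zero    = refl
  filter-prime-to-p (suc q) = begin
    filter prime-to-p (applyUpTo suc (p + q * p))
      ≡⟨ cong (filter prime-to-p ∘ applyUpTo suc) (+-comm p (q * p)) ⟩
    filter prime-to-p (applyUpTo suc (q * p + p))
      ≡⟨ cong (filter prime-to-p) (applyUpTo-++ suc (q * p) p) ⟩
    filter prime-to-p (applyUpTo suc (q * p) ++ applyUpTo (λ i → suc (q * p + i)) p)
      ≡⟨ filter-++ prime-to-p (applyUpTo suc (q * p)) _ ⟩
    filter prime-to-p (applyUpTo suc (q * p)) ++ filter prime-to-p (applyUpTo (λ i → suc (q * p + i)) p)
      ≡⟨ cong₂ _++_ (filter-prime-to-p q) (filter-block q) ⟩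
    applyUpTo nthCoprime (q * suc r) ++ applyUpTo (λ t → nthCoprime (q * suc r + t)) (suc r)
      ≡⟨ applyUpTo-++ nthCoprime (q * suc r) (suc r) ⟨
    applyUpTo nthCoprime (q * suc r + suc r)
      ≡⟨ cong (applyUpTo nthCoprime) (+-comm (q * suc r) (suc r)) ⟩
    applyUpTo nthCoprime (suc q * suc r)
      ∎
    where open ≡-Reasoning

  coprimeNth≡nthCoprime : ∀ j → coprimeNth p j ≡ nthCoprime j
  coprimeNth≡nthCoprime j = begin
    nth (filter prime-to-p (map suc (upTo (suc j * p)))) j
      ≡⟨ cong (λ l → nth (filter prime-to-p l) j) (map-upTo suc (suc j * p)) ⟩
    nth (filter prime-to-p (applyUpTo suc (suc j * p))) j
      ≡⟨ cong (λ l → nth l j) (filter-prime-to-p (suc j)) ⟩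
    nth (applyUpTo nthCoprime (suc j * suc r)) j
      ≡⟨ nth-applyUpTo nthCoprime (m≤m*n (suc j) (suc r)) ⟩
    nthCoprime j
      ∎
    where open ≡-Reasoning

  p∤nthCoprime : ∀ j → ¬ p ∣ nthCoprime j
  p∤nthCoprime j = subst (λ m → ¬ p ∣ m) nthCoprime-j≡
    (p∤[qp+1+i] (j / suc r) (j % suc r) (m%n<n j (suc r)))
    where
    nthCoprime-j≡ : suc (j / suc r * p + j % suc r) ≡ nthCoprime j
    nthCoprime-j≡ = begin
      suc (j / suc r * p + j % suc r)            ≡⟨ nthCoprime-block (j / suc r) (j % suc r) (m%n<n j (suc r)) ⟨
      nthCoprime (j / suc r * suc r + j % suc r) ≡⟨ cong nthCoprime (+-comm _ (j % suc r)) ⟩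
      nthCoprime (j % suc r + j / suc r * suc r) ≡⟨ cong nthCoprime (m≡m%n+[m/n]*n j (suc r)) ⟨
      nthCoprime j                               ∎
      where open ≡-Reasoning

  nthCoprime-strictMono : ∀ {a b} → a < b → nthCoprime a < nthCoprime b
  nthCoprime-strictMono a<b = +-monoˡ-< 1 (+-mono-<-≤ a<b (/-monoˡ-≤ (suc r) (<⇒≤ a<b)))

  nthCoprime-injective : ∀ {a b} → nthCoprime a ≡ nthCoprime b → a ≡ b
  nthCoprime-injective {a} {b} eq with <-cmp a b
  ... | tri< a<b _ _ = ⊥-elim (<⇒≢ (nthCoprime-strictMono a<b) eq)
  ... | tri≈ _ a≡b _ = a≡b
  ... | tri> _ _ b<a = ⊥-elim (<⇒≢ (nthCoprime-strictMono b<a) (sym eq))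

  nthCoprime-shift : ∀ a A j → nthCoprime (a + A * φ (suc j)) ≡ nthCoprime a + A * p ^ suc j
  nthCoprime-shift a A j = begin
    a + A * (Q * P) + (a + A * (Q * P)) / Q + 1
      ≡⟨ cong (λ z → a + A * (Q * P) + (a + z) / Q + 1) (trans (cong (A *_) (*-comm Q P)) (sym (*-assoc A P Q))) ⟩
    a + A * (Q * P) + (a + A * P * Q) / Q + 1
      ≡⟨ cong (λ z → a + A * (Q * P) + z + 1) (+-distrib-/-∣ʳ a (n∣m*n (A * P))) ⟩
    a + A * (Q * P) + (a / Q + A * P * Q / Q) + 1
      ≡⟨ cong (λ z → a + A * (Q * P) + (a / Q + z) + 1) (m*n/n≡m (A * P) Q) ⟩
    a + A * (Q * P) + (a / Q + A * P) + 1
      ≡⟨ solve 5 (λ a b A P r → a :+ A :* ((con 1 :+ r) :* P) :+ (b :+ A :* P) :+ con 1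
                              := a :+ b :+ con 1 :+ A :* ((con 2 :+ r) :* P)) refl a (a / Q) A P r ⟩
    a + a / Q + 1 + A * (p * P)
      ∎
    where
    open ≡-Reasoning
    Q P : ℕ
    Q = suc r
    P = p ^ j

  nthCoprime-< : ∀ a j → a < φ (suc j) → nthCoprime a < p ^ suc j
  nthCoprime-< a j a<QP = begin-strict
    a + a / Q + 1      ≡⟨ trans (+-comm _ 1) (sym (+-suc a (a / Q))) ⟩
    a + suc (a / Q)    <⟨ +-mono-<-≤ a<QP (m<n*o⇒m/o<n (subst (a <_) (*-comm Q P) a<QP)) ⟩
    Q * P + P          ≡⟨ +-comm (Q * P) P ⟩
    p * P              ∎
    where
    open ≤-Reasoning
    Q P : ℕ
    Q = suc r
    P = p ^ j

  nthCoprime-mod : ∀ x j → nthCoprime x mod′ (p ^ suc j) ≡ nthCoprime (x mod′ φ (suc j))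
  nthCoprime-mod x j = begin
    nthCoprime x mod′ (p ^ suc j)                         ≡⟨ cong (λ z → nthCoprime z mod′ (p ^ suc j)) (mod′+div′* x (φ (suc j))) ⟩
    nthCoprime (a + A * φ (suc j)) mod′ (p ^ suc j)      ≡⟨ cong (_mod′ (p ^ suc j)) (nthCoprime-shift a A j) ⟩
    (nthCoprime a + A * p ^ suc j) mod′ (p ^ suc j)      ≡⟨ mod′-+* (nthCoprime a) A (p ^ suc j) ⟩
    nthCoprime a mod′ (p ^ suc j)                         ≡⟨ <⇒mod′-id (nthCoprime-< a j (mod′< x (φ (suc j)))) ⟩
    nthCoprime a                                          ∎
    where
    open ≡-Reasoning
    instance
      _ = pᵏ≢0 (suc j)
      _ = φ≢0 (suc j)
    a A : ℕ
    a = x mod′ φ (suc j)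
    A = x div′ φ (suc j)

  nthCoprime-congruent : ∀ x s j → nthCoprime x mod′ (p ^ suc j) ≡ nthCoprime s mod′ (p ^ suc j) →
    x mod′ φ (suc j) ≡ s mod′ φ (suc j)
  nthCoprime-congruent x s j eq =
    nthCoprime-injective (trans (sym (nthCoprime-mod x j)) (trans eq (nthCoprime-mod s j)))

  embed : ℕ → ℤₚ p
  embed c = mkℤₚ (λ k → c mod′ (p ^ k))
                 (λ k → mod′< c (p ^ k) {{pᵏ≢0 k}})
                 (λ k → mod′-mod′-* c p (p ^ k) {{_}} {{pᵏ≢0 k}})

  embed-unit : Prime p → ∀ c → ¬ p ∣ c → IsUnit (embed c)
  embed-unit p-prime c p∤c = mkℤₚ u u<pᵏ u-compat , c*u≡1
    where
    inverse : ∀ k → ∃ λ v → (c * v) mod′ (p ^ k) ≡ 1 mod′ (p ^ k)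
    inverse k = mod′-inverse (p ^ k) {{pᵏ≢0 k}} (coprime-^ p-prime p∤c k)
    u : ℕ → ℕ
    u k = proj₁ (inverse k) mod′ (p ^ k)
    u<pᵏ : ∀ k → u k < p ^ k
    u<pᵏ k = mod′< _ (p ^ k) {{pᵏ≢0 k}}
    cu≡1 : ∀ k → (c * u k) mod′ (p ^ k) ≡ 1 mod′ (p ^ k)
    cu≡1 k = trans (*-mod′-absorbʳ c _ (p ^ k) {{pᵏ≢0 k}}) (proj₂ (inverse k))
    u-compat : ∀ k → u (suc k) mod′ (p ^ k) ≡ u k
    u-compat k = trans (inverse-unique {c} (p ^ k) cu′≡1 (cu≡1 k)) (<⇒mod′-id (u<pᵏ k))
      where
      instance _ = pᵏ≢0 k
      cu′≡1 : (c * u (suc k)) mod′ (p ^ k) ≡ 1 mod′ (p ^ k)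
      cu′≡1 = begin
        (c * u (suc k)) mod′ (p ^ k)                       ≡⟨ mod′-mod′-* (c * u (suc k)) p (p ^ k) ⟨
        ((c * u (suc k)) mod′ (p ^ suc k)) mod′ (p ^ k)    ≡⟨ cong (_mod′ (p ^ k)) (cu≡1 (suc k)) ⟩
        (1 mod′ (p ^ suc k)) mod′ (p ^ k)                  ≡⟨ mod′-mod′-* 1 p (p ^ k) ⟩
        1 mod′ (p ^ k)                                     ∎
        where open ≡-Reasoning
    c*u≡1 : ∀ k → (c mod′ (p ^ k) * u k) mod′ (p ^ k) ≡ 1 mod′ (p ^ k)
    c*u≡1 k = begin
      (c mod′ (p ^ k) * u k) mod′ (p ^ k)   ≡⟨ cong (_mod′ (p ^ k)) (*-comm _ (u k)) ⟩
      (u k * c mod′ (p ^ k)) mod′ (p ^ k)   ≡⟨ *-mod′-absorbʳ (u k) c (p ^ k) ⟩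
      (u k * c) mod′ (p ^ k)                ≡⟨ cong (_mod′ (p ^ k)) (*-comm (u k) c) ⟩
      (c * u k) mod′ (p ^ k)                ≡⟨ cu≡1 k ⟩
      1 mod′ (p ^ k)                        ∎
      where
      open ≡-Reasoning
      instance _ = pᵏ≢0 k

  n<pⁿ : ∀ n → n < p ^ n
  n<pⁿ zero    = s≤s z≤n
  n<pⁿ (suc n) = begin
    suc (suc n)            ≡⟨ +-comm 1 (suc n) ⟩
    suc n + 1              ≤⟨ +-mono-≤ (n<pⁿ n) (m^n>0 p n) ⟩
    p ^ n + p ^ n          ≤⟨ +-monoʳ-≤ (p ^ n) (m≤m+n (p ^ n) (r * p ^ n)) ⟩
    p ^ suc n              ∎
    where open ≤-Reasoning

  module FirstCoprimes (p-prime : Prime p) (n : ℕ) where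

    S : Fin n → ℤₚ p
    S i = embed (coprimeNth p (toℕ i))

    units : ∀ i → IsUnit (S i)
    units i = embed-unit p-prime _
      (subst (λ m → ¬ p ∣ m) (sym (coprimeNth≡nthCoprime (toℕ i))) (p∤nthCoprime (toℕ i)))

    congruent : ∀ x s j → res (S x) (suc j) ≡ res (S s) (suc j) →
      toℕ x mod′ φ (suc j) ≡ toℕ s mod′ φ (suc j)
    congruent x s j = nthCoprime-congruent (toℕ x) (toℕ s) j
      ∘ subst₂ (λ a b → a mod′ (p ^ suc j) ≡ b mod′ (p ^ suc j))
               (coprimeNth≡nthCoprime (toℕ x)) (coprimeNth≡nthCoprime (toℕ s))

    congruent-deep : ∀ x s j → n ≤ j → res (S x) (suc j) ≡ res (S s) (suc j) → x ≡ s
    congruent-deep x s j n≤j eq = F.toℕ-injective (begin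
      toℕ x                    ≡⟨ <⇒mod′-id (<-≤-trans (F.toℕ<n x) n≤φ) ⟨
      toℕ x mod′ φ (suc j)     ≡⟨ congruent x s j eq ⟩
      toℕ s mod′ φ (suc j)     ≡⟨ <⇒mod′-id (<-≤-trans (F.toℕ<n s) n≤φ) ⟩
      toℕ s                    ∎)
      where
      open ≡-Reasoning
      instance _ = φ≢0 (suc j)
      n≤φ : n ≤ φ (suc j)
      n≤φ = ≤-trans (<⇒≤ (n<pⁿ n)) (≤-trans (^-monoʳ-≤ p n≤j) (m≤n*m (p ^ j) (suc r)))

    distinct : Distinct S
    distinct x s x≢s = suc n , x≢s ∘ congruent-deep x s n ≤-refl ∘ sub≡0⇒res≡ (S x) (S s) (suc n)

    open Agreement S

    agreeCount-bound : ∀ x j → agreeCount x (suc j) ≤ (n ∸ 1) div′ φ (suc j)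
    agreeCount-bound x j = ≤-pred (begin
      suc (agreeCount x (suc j))  ≡⟨ count-remove Z x (≡⇒≡ᵇ _ 0 (res≡⇒sub≡0 (S x) (S x) (suc j) refl)) ⟨
      count Z                     ≤⟨ count≤-injective (suc ((n ∸ 1) div′ φ (suc j))) Z quotient quotient< quotient-injective ⟩
      suc ((n ∸ 1) div′ φ (suc j)) ∎)
      where
      open ≤-Reasoning
      instance _ = φ≢0 (suc j)
      Z : Fin n → Bool
      Z s = sub (S x) (S s) (suc j) ≡ᵇ 0
      quotient : Fin n → ℕ
      quotient s = toℕ s div′ φ (suc j)
      quotient< : ∀ s → T (Z s) → quotient s < suc ((n ∸ 1) div′ φ (suc j))
      quotient< s _ = s≤s (div′-monoˡ-≤ (φ (suc j)) (toℕ≤n∸1 s))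
      residue≡ : ∀ s → T (Z s) → toℕ x mod′ φ (suc j) ≡ toℕ s mod′ φ (suc j)
      residue≡ s Zs = congruent x s j (sub≡0⇒res≡ (S x) (S s) (suc j) (≡ᵇ⇒≡ _ 0 Zs))
      quotient-injective : ∀ s s′ → T (Z s) → T (Z s′) → quotient s ≡ quotient s′ → s ≡ s′
      quotient-injective s s′ Zs Zs′ = F.toℕ-injective ∘
        mod′-div′-injective (φ (suc j)) (trans (sym (residue≡ s Zs)) (residue≡ s′ Zs′))

    upperBound : ∀ x → vS S distinct x ≤ f p n
    upperBound x = begin
      vS S distinct x            ≤⟨ vS≤agreeCount distinct x n apart-above-n ⟩
      sumFrom1 (agreeCount x) n  ≤⟨ sumFrom1-mono n _ _ (λ { (suc j) _ _ → agreeCount-bound x j }) ⟩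
      f p n                      ∎
      where
      open ≤-Reasoning
      apart-above-n : ∀ s i → n < i → x ≢ s → sub (S x) (S s) i ≢ 0
      apart-above-n s (suc j) (s≤s n≤j) x≢s = x≢s ∘ congruent-deep x s j n≤j ∘ sub≡0⇒res≡ (S x) (S s) (suc j)

    isMax : 0 < n → IsMax (vS S distinct) (f p n)
    isMax 0<n = let x , f≤vSx = LowerBound.lowerBound S units 0<n distinct in
      upperBound , x , ≤-antisym (upperBound x) f≤vSx

proposition3p2 : (p : ℕ) → Prime p →
    ((n : ℕ) → 1 ≤ n → (S : Fin n → ℤₚ p) → (∀ i → IsUnit (S i)) → (d : Distinct S) →
      Σ (Fin n) λ x → f p n ≤ vS S d x)
    × ((n : ℕ) → 1 ≤ n → Σ (Fin n → ℤₚ p) λ S → (∀ i → IsUnit (S i)) ×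
      Σ (Distinct S) λ d → IsMax (vS S d) (f p n))
    × ((n : ℕ) → 1 ≤ n → Σ (Fin n → ℤₚ p) λ S →
      (∀ i k → res (S i) k ≡ coprimeNth p (toℕ i) mod′ (p ^ k)) × (∀ i → IsUnit (S i)) ×
      Σ (Distinct S) λ d → IsMax (vS S d) (f p n))
proposition3p2 zero          p-prime with () ← prime⇒nonTrivial p-prime
proposition3p2 (suc zero)    p-prime with () ← prime⇒nonTrivial p-prime
proposition3p2 (suc (suc r)) p-prime =
    (λ n 0<n S units → LowerBound.lowerBound S units 0<n)
  , (λ n 0<n → let open FirstCoprimes p-prime n in S , units , distinct , isMax 0<n)
  , (λ n 0<n → let open FirstCoprimes p-prime n in S , (λ _ _ → refl) , units , distinct , isMax 0<n)
  where open Padic r
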